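{- Let $G$ be a graph with $n$ vertices. The leaf reconfiguration strategy $\mathcal{S}$ defined below is reversible.
   Context: For a spanning tree $T$ of $G$, let $L(T)$ be its set of leaves (vertices of degree $1$ in $T$), and for $v\in L(T)$ let its parent $p_T(v)$ be its unique neighbour in $T$. A leaf selection for $T$ is a pair $(L,P)$ where $L\subseteq L(T)$ and $P=(P(v))_{v\in L}$ are sets with $p_T(v)\in P(v)\subseteq N_G(v)\setminus L$ for each $v\in L$. An $(L,P)$-leaf reconfiguration of $T$ consists of removing, for each $v\in L$, the edge $vp_T(v)$ and adding an edge between $v$ and some vertex of $P(v)$. A leaf reconfiguration strategy is a function taking a spanning tree $T$ and a value $R$ of a random variable and outputting a leaf selection for $T$; it is reversible if for every spanning tree $T$ and every value $R$: whenever $T'$ can be obtained from $T$ by an $\mathcal{S}(T,R)$-leaf reconfiguration, then $\mathcal{S}(T',R)=\mathcal{S}(T,R)$. The strategy $\mathcal{S}$: the random variable is a subset $R\subseteq V(G)$. Given a spanning tree $T$ and $R\subseteq V(G)$, for each vertex $v$ let $P_1(v)=\{u\in N_G(v): u\notin R\text{ or } d_G(u)>n^{1/3}\}$ and $P_2(v)=\{u\in N_G(v): u\notin R\text{ or } |N_T(u)\setminus R|\ge 2\}$. Let $L_1=\{v\in L(T)\cap R: d_G(v)\le n^{1/3},\ p_T(v)\in P_1(v),\ |P_1(v)|\ge d_G(v)/2\}$ and $L_2=\{v\in L(T)\cap R: d_G(v)> n^{1/3},\ p_T(v)\in P_2(v),\ |P_2(v)|\ge d_G(v)/4\}$. Then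 $\mathcal{S}(T,R)=(L_1,P_1)$ if $|L_1|\ge n/256$, and $\mathcal{S}(T,R)=(L_2,P_2)$ otherwise (with $P_i$ restricted to the indices in $L_i$). -}

module Defs where

open import Data.Bool using (Bool; true; false; _∧_; _∨_; not; if_then_else_)
open import Data.Nat using (ℕ; zero; suc; _*_; _^_; _≤_; _<_; _≤?_; _<?_)
open import Data.Nat.Properties using (_≟_)
open import Data.Fin using (Fin; zero; suc)
open import Data.Fin.Subset using (Subset; _∈_; _∉_; _⊆_; _─_; ∣_∣)
open import Data.Fin.Subset.Properties using (_∈?_)
open import Data.Vec using (Vec; []; _∷_; tabulate; lookup)
open import Data.List using (List; []; _∷_; _++_; [_]; length)
open import Data.List.Relation.Unary.Unique.Propositional using (Unique)
open import Data.Maybe using (Maybe; just; nothing)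
open import Data.Product using (Σ; _×_; _,_; ∃)
open import Data.Sum using (_⊎_)
open import Data.Unit using (⊤)
open import Data.Empty using (⊥)
open import Relation.Nullary using (¬_)
open import Relation.Nullary.Decidable using (⌊_⌋)
open import Relation.Binary.PropositionalEquality using (_≡_)

record Graph (n : ℕ) : Set where
  field
    N      : Fin n → Subset n
    sym    : ∀ u v → u ∈ N v → v ∈ N u
    irrefl : ∀ v → v ∉ N v
open Graph public

deg : ∀ {n} → Graph n → Fin n → ℕ
deg G v = ∣ N G v ∣

-- An edge set on Fin n, represented by neighbourhoods (E u = N_T(u)).
EdgeSet : ℕ → Set
EdgeSet n = Fin n → Subset n

data Reach {n} (E : EdgeSet n) (u : Fin n) : Fin n → Set where
  here  : Reach E u u
  there : ∀ {v w} → Reach E u v → w ∈ E v → Reach E u w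

Chain : ∀ {n} → EdgeSet n → List (Fin n) → Set
Chain E []           = ⊤
Chain E (x ∷ [])     = ⊤
Chain E (x ∷ y ∷ xs) = (y ∈ E x) × Chain E (y ∷ xs)

Cycle : ∀ {n} → EdgeSet n → Set
Cycle {n} E = Σ (Fin n) λ x → Σ (List (Fin n)) λ ys →
  Unique (x ∷ ys) × (2 ≤ length ys) × Chain E (x ∷ ys ++ [ x ])

record IsSpanningTree {n} (G : Graph n) (T : EdgeSet n) : Set where
  field
    sub       : ∀ v → T v ⊆ N G v
    symm      : ∀ u v → u ∈ T v → v ∈ T u
    connected : ∀ u v → Reach T u v
    acyclic   : ¬ Cycle T
open IsSpanningTree public

isLeaf : ∀ {n} → EdgeSet n → Fin n → Bool
isLeaf T v = ⌊ ∣ T v ∣ ≟ 1 ⌋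

pick : ∀ {n} → Subset n → Maybe (Fin n)
pick []            = nothing
pick (true ∷ p)    = just zero
pick (false ∷ p)   with pick p
... | just i  = just (suc i)
... | nothing = nothing

parent : ∀ {n} → EdgeSet n → Fin n → Maybe (Fin n)
parent T v = pick (T v)

parentIn : ∀ {n} → EdgeSet n → Fin n → Subset n → Bool
parentIn T v P with parent T v
... | just u  = lookup P u
... | nothing = false

-- Leaf selections: L together with a family P (only P v for v ∈ L matters).
LeafSelection : ℕ → Set
LeafSelection n = Subset n × (Fin n → Subset n)

-- T' is obtained from T by an (L,P)-leaf reconfiguration: for some choice
-- c(v) ∈ P(v) (v ∈ L), the edges v p_T(v) (v ∈ L) are removed and the edges
-- v c(v) are added.  Since T is a tree and P(v) ∩ L = ∅, the removed edges are
-- exactly the T-edges incident to L.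
LeafReconf : ∀ {n} → EdgeSet n → LeafSelection n → EdgeSet n → Set
LeafReconf {n} T (L , P) T' = Σ (Fin n → Fin n) λ c →
  (∀ v → v ∈ L → c v ∈ P v) ×
  (∀ x y → (y ∈ T' x) ⇔'
     ((y ∈ T x × x ∉ L × y ∉ L) ⊎ (x ∈ L × y ≡ c x) ⊎ (y ∈ L × x ≡ c y)))
  where
  _⇔'_ : Set → Set → Set
  A ⇔' B = (A → B) × (B → A)

SameSelection : ∀ {n} → LeafSelection n → LeafSelection n → Set
SameSelection (L , P) (L' , P') = (L ≡ L') × (∀ v → v ∈ L → P v ≡ P' v)

_∈ᵇ_ : ∀ {n} → Fin n → Subset n → Bool
x ∈ᵇ p = lookup p x

-- Real-valued thresholds are expressed exactly over ℕ:
--   d ≤ n^{1/3} ⇔ d^3 ≤ n ;  d > n^{1/3} ⇔ n < d^3 ;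
--   |P| ≥ d/2 ⇔ d ≤ 2|P| ;  |P| ≥ d/4 ⇔ d ≤ 4|P| ;  |L| ≥ n/256 ⇔ n ≤ 256|L|.
module Strategy {n : ℕ} (G : Graph n) (T : EdgeSet n) (R : Subset n) where

  P₁ : Fin n → Subset n
  P₁ v = tabulate λ u → (u ∈ᵇ N G v) ∧ (not (u ∈ᵇ R) ∨ ⌊ n <? deg G u ^ 3 ⌋)

  P₂ : Fin n → Subset n
  P₂ v = tabulate λ u → (u ∈ᵇ N G v) ∧ (not (u ∈ᵇ R) ∨ ⌊ 2 ≤? ∣ T u ─ R ∣ ⌋)

  L₁ : Subset n
  L₁ = tabulate λ v → isLeaf T v ∧ (v ∈ᵇ R) ∧ ⌊ deg G v ^ 3 ≤? n ⌋
                      ∧ parentIn T v (P₁ v) ∧ ⌊ deg G v ≤? 2 * ∣ P₁ v ∣ ⌋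

  L₂ : Subset n
  L₂ = tabulate λ v → isLeaf T v ∧ (v ∈ᵇ R) ∧ ⌊ n <? deg G v ^ 3 ⌋
                      ∧ parentIn T v (P₂ v) ∧ ⌊ deg G v ≤? 4 * ∣ P₂ v ∣ ⌋

  𝒮 : LeafSelection n
  𝒮 = if ⌊ n ≤? 256 * ∣ L₁ ∣ ⌋ then (L₁ , P₁) else (L₂ , P₂)

strategy : ∀ {n} → Graph n → EdgeSet n → Subset n → LeafSelection n
strategy G T R = Strategy.𝒮 G T R

Reversible : ∀ {n} → Graph n → (EdgeSet n → Subset n → LeafSelection n) → Set
Reversible {n} G S = ∀ (T T' : EdgeSet n) (R : Subset n) →
  IsSpanningTree G T → LeafReconf T (S T R) T' → SameSelection (S T' R) (S T R)

{-# OPTIONS --safe #-}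
-- Let (L , P) be the selection made for T and T' the result
-- of an (L , P)-reconfiguration.  As P(v) avoids L, every v ∈ L is a leaf of T' whose parent
-- lies in P(v); every vertex outside L keeps its adjacencies to vertices outside L, and keeps
-- its whole neighbourhood unless it lies in some P(v).  Membership of v in L₁ or L₂ depends on
-- the tree only through "v is a leaf whose parent lies in P(v)", so it suffices that every
-- candidate is selected or keeps its neighbourhood.  For (L₁ , P₁): candidates are low-degree
-- vertices of R, while P₁ only contains vertices outside R or of high degree.  For (L₂ , P₂):
-- since L₂ ⊆ R, the number of tree-neighbours outside R is unchanged off L₂ and below 2 on L₂,
-- so P₂ is unchanged, and a vertex of R that is a leaf of T or T' lies in no P₂(v).  Hence L₁
-- (and with it the choice between the two cases) is preserved, and so are L₂ and P₂ when
-- (L₂ , P₂) was chosen.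
module Submission where

open import Defs hiding (sym)
open import Data.Bool using (Bool; true; false; T; not; _∧_; _∨_; if_then_else_)
open import Data.Bool.Properties using (T-≡; T-∧)
open import Data.Nat using (ℕ; _≤_; _≤?_; _<?_; _*_; _^_)
open import Data.Nat.Properties using (_≟_; <⇒≱; ≤⇒≯; ≤-trans; ≤-reflexive; suc-injective)
open import Data.Fin using (Fin)
open import Data.Fin.Subset using (Subset; _∈_; _∉_; _⊆_; _─_; ∣_∣; ⁅_⁆; inside; outside)
open import Data.Fin.Subset.Properties
  using (_∈?_; ⊆-antisym; x∈⁅x⁆; x∈⁅y⁆⇒x≡y; ∣⁅x⁆∣≡1; ∣p─q∣≤∣p∣; p─q⊆p; x∈p∧x∉q⇒x∈p─q)
open import Data.Vec using (_∷_; lookup; tabulate; here; there)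
open import Data.Vec.Properties using (lookup∘tabulate; tabulate-cong; []=⇒lookup; lookup⇒[]=)
open import Data.Maybe using (just; nothing; maybe′)
open import Data.Product using (_×_; _,_; proj₁; proj₂)
open import Data.Sum using (_⊎_; inj₁; inj₂)
import Data.Sum as Sum
open import Function using (_∘_; _$_; Equivalence)
open import Relation.Nullary using (¬_; yes; no; contradiction)
open import Relation.Nullary.Decidable using (⌊_⌋; toWitness; fromWitness)
open import Relation.Binary.PropositionalEquality
  using (_≡_; _≢_; refl; sym; trans; cong; cong₂; subst)

private
  variable
    n : ℕ
    x y u v : Fin n
    p q S : Subset n

T⇒≡true : ∀ {b} → T b → b ≡ true
T⇒≡true = Equivalence.to T-≡

T-∧⁻ : ∀ {a b} → T (a ∧ b) → T a × T b
T-∧⁻ = Equivalence.to T-∧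

∈⇒T-lookup : x ∈ p → T (lookup p x)
∈⇒T-lookup = Equivalence.from T-≡ ∘ []=⇒lookup

T-lookup⇒∈ : T (lookup p x) → x ∈ p
T-lookup⇒∈ {p = p} {x = x} = lookup⇒[]= x p ∘ T⇒≡true

∈-tabulate⁻ : ∀ {f : Fin n → Bool} → x ∈ tabulate f → T (f x)
∈-tabulate⁻ {x = x} {f = f} m = subst T (lookup∘tabulate f x) (∈⇒T-lookup m)

∈-tabulate⁺ : ∀ {f : Fin n → Bool} → T (f x) → x ∈ tabulate f
∈-tabulate⁺ {x = x} {f = f} t = T-lookup⇒∈ (subst T (sym (lookup∘tabulate f x)) t)

T-not∨⁻ : ∀ {a b} → T (not a ∨ b) → T a → T b
T-not∨⁻ {true} b _ = b

≡-if-T-either : ∀ {a b : Bool} → (T a ⊎ T b → a ≡ b) → a ≡ b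
≡-if-T-either {false} {false} _ = refl
≡-if-T-either {true}          h = h (inj₁ _)
≡-if-T-either {false} {true}  h = h (inj₂ _)

x∈p─q⇒x∉q : x ∈ p ─ q → x ∉ q
x∈p─q⇒x∉q {p = _ ∷ _} {q = inside  ∷ _} (there x∈p─q) (there x∈q) = x∈p─q⇒x∉q x∈p─q x∈q
x∈p─q⇒x∉q {p = _ ∷ _} {q = outside ∷ _} (there x∈p─q) (there x∈q) = x∈p─q⇒x∉q x∈p─q x∈q

x∈p⇒∣p∣≢0 : x ∈ p → ∣ p ∣ ≢ 0
x∈p⇒∣p∣≢0 {p = inside  ∷ _} _           ()
x∈p⇒∣p∣≢0 {p = outside ∷ _} (there x∈p) = x∈p⇒∣p∣≢0 x∈p

∣p∣≡1⇒¬2≤∣p─q∣ : ∣ p ∣ ≡ 1 → ¬ 2 ≤ ∣ p ─ q ∣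
∣p∣≡1⇒¬2≤∣p─q∣ {p = p} {q = q} ∣p∣≡1 = ≤⇒≯ (≤-trans (∣p─q∣≤∣p∣ p q) (≤-reflexive ∣p∣≡1))

pick-singleton : ∣ p ∣ ≡ 1 → x ∈ p → pick p ≡ just x
pick-singleton {p = inside  ∷ _} _      here        = refl
pick-singleton {p = inside  ∷ _} ∣p∣≡1 (there x∈p) =
  contradiction (suc-injective ∣p∣≡1) (x∈p⇒∣p∣≢0 x∈p)
pick-singleton {p = outside ∷ p} ∣p∣≡1 (there x∈p) rewrite pick-singleton ∣p∣≡1 x∈p = refl

private
  variable
    E E' : EdgeSet n
    P : Subset n

parentIn-via-pick : ∀ (E : EdgeSet n) v P → parentIn E v P ≡ maybe′ (lookup P) false (pick (E v))
parentIn-via-pick E v P with parent E v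
... | just _  = refl
... | nothing = refl

parentIn-of-leaf : ∣ E v ∣ ≡ 1 → u ∈ E v → parentIn E v P ≡ lookup P u
parentIn-of-leaf {E = E} {v = v} {P = P} leaf u∈Ev =
  trans (parentIn-via-pick E v P) (cong (maybe′ (lookup P) false) (pick-singleton leaf u∈Ev))

record IsLeafInto (E : EdgeSet n) (v : Fin n) (P : Subset n) : Set where
  constructor leafInto
  field
    leaf     : ∣ E v ∣ ≡ 1
    parent∈P : T (parentIn E v P)

leafInto-parent∈ : IsLeafInto E v P → u ∈ E v → u ∈ P
leafInto-parent∈ {E = E} {v = v} {P = P} (leafInto leaf parent∈P) u∈Ev =
  T-lookup⇒∈ (subst T (parentIn-of-leaf {E = E} {v = v} {P = P} leaf u∈Ev) parent∈P)

record SameLeafStatus (E E' : EdgeSet n) (v : Fin n) (P : Subset n) : Set where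
  constructor sameLeafStatus
  field
    same-isLeaf   : isLeaf E' v ≡ isLeaf E v
    same-parentIn : parentIn E' v P ≡ parentIn E v P

sameLeafStatus-nbhd : E' v ≡ E v → SameLeafStatus E E' v P
sameLeafStatus-nbhd {E' = E'} {v = v} {E = E} {P = P} eq =
  sameLeafStatus (cong (λ s → ⌊ ∣ s ∣ ≟ 1 ⌋) eq) $
  trans (parentIn-via-pick E' v P)
        (trans (cong (maybe′ (lookup P) false ∘ pick) eq) (sym (parentIn-via-pick E v P)))

sameLeafStatus-leafInto : IsLeafInto E v P → IsLeafInto E' v P → SameLeafStatus E E' v P
sameLeafStatus-leafInto {E = E} {v = v} {E' = E'} (leafInto leaf parent∈P) (leafInto leaf' parent∈P') =
  sameLeafStatus (trans (isLeaf≡true E' leaf') (sym (isLeaf≡true E leaf))) $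
  trans (T⇒≡true parent∈P') (sym (T⇒≡true parent∈P))
  where
  isLeaf≡true : ∀ F → ∣ F v ∣ ≡ 1 → isLeaf F v ≡ true
  isLeaf≡true F leaf = T⇒≡true (fromWitness {a? = ∣ F v ∣ ≟ 1} leaf)

-- A leaf selection in the sense of the paper, minus P(v) ⊆ N_G(v), which reversibility never uses.
record IsLeafSelection (E : EdgeSet n) (L : Subset n) (P : Fin n → Subset n) : Set where
  field
    selected-leafInto : v ∈ L → IsLeafInto E v (P v)
    P-avoids-L        : v ∈ L → u ∈ P v → u ∉ L

module Reconfiguration {n} {E E' : EdgeSet n} {L : Subset n} {P : Fin n → Subset n}
  (E-sym : ∀ u v → u ∈ E v → v ∈ E u) (selection : IsLeafSelection E L P)
  (reconf : LeafReconf E (L , P) E') where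

  open IsLeafSelection selection public

  private
    c : Fin n → Fin n
    c = proj₁ reconf

    c∈P : v ∈ L → c v ∈ P v
    c∈P = proj₁ (proj₂ reconf) _

    edge⁻ : y ∈ E' x → (y ∈ E x × x ∉ L × y ∉ L) ⊎ (x ∈ L × y ≡ c x) ⊎ (y ∈ L × x ≡ c y)
    edge⁻ = proj₁ (proj₂ (proj₂ reconf) _ _)

    new-edge⁺ : x ∈ L → y ≡ c x → y ∈ E' x
    new-edge⁺ x∈L y≡cx = proj₂ (proj₂ (proj₂ reconf) _ _) (inj₂ (inj₁ (x∈L , y≡cx)))

  unselected-adjacency⁺ : x ∉ L → y ∉ L → y ∈ E x → y ∈ E' x
  unselected-adjacency⁺ x∉L y∉L y∈Ex = proj₂ (proj₂ (proj₂ reconf) _ _) (inj₁ (y∈Ex , x∉L , y∉L))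

  unselected-adjacency⁻ : x ∉ L → y ∉ L → y ∈ E' x → y ∈ E x
  unselected-adjacency⁻ x∉L y∉L y∈E'x with edge⁻ y∈E'x
  ... | inj₁ (y∈Ex , _)       = y∈Ex
  ... | inj₂ (inj₁ (x∈L , _)) = contradiction x∈L x∉L
  ... | inj₂ (inj₂ (y∈L , _)) = contradiction y∈L y∉L

  selected-nbhd : v ∈ L → E' v ≡ ⁅ c v ⁆
  selected-nbhd {v = v} v∈L =
    ⊆-antisym new-edges (λ y∈⁅cv⁆ → new-edge⁺ v∈L (x∈⁅y⁆⇒x≡y (c v) y∈⁅cv⁆))
    where
    new-edges : E' v ⊆ ⁅ c v ⁆
    new-edges y∈E'v with edge⁻ y∈E'v
    ... | inj₁ (_ , v∉L , _)       = contradiction v∈L v∉L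
    ... | inj₂ (inj₁ (_ , refl))   = x∈⁅x⁆ (c v)
    ... | inj₂ (inj₂ (y∈L , refl)) = contradiction v∈L (P-avoids-L y∈L (c∈P y∈L))

  reconfigured-leafInto : v ∈ L → IsLeafInto E' v (P v)
  reconfigured-leafInto {v = v} v∈L =
    leafInto leaf (subst T (sym (parentIn-of-leaf {E = E'} leaf cv∈E'v)) (∈⇒T-lookup (c∈P v∈L)))
    where
    leaf : ∣ E' v ∣ ≡ 1
    leaf = trans (cong ∣_∣ (selected-nbhd v∈L)) (∣⁅x⁆∣≡1 (c v))
    cv∈E'v : c v ∈ E' v
    cv∈E'v = new-edge⁺ v∈L refl

  selected-status : v ∈ L → SameLeafStatus E E' v (P v)
  selected-status v∈L = sameLeafStatus-leafInto (selected-leafInto v∈L) (reconfigured-leafInto v∈L)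

  unselected-nbhd-─ : L ⊆ S → x ∉ L → E' x ─ S ≡ E x ─ S
  unselected-nbhd-─ {S = S} {x = x} L⊆S x∉L = ⊆-antisym
    (λ y∈ → x∈p∧x∉q⇒x∈p─q (unselected-adjacency⁻ x∉L (y∉L y∈) (p─q⊆p (E' x) S y∈)) (x∈p─q⇒x∉q y∈))
    (λ y∈ → x∈p∧x∉q⇒x∈p─q (unselected-adjacency⁺ x∉L (y∉L y∈) (p─q⊆p (E x) S y∈)) (x∈p─q⇒x∉q y∈))
    where
    y∉L : ∀ {y p} → y ∈ p ─ S → y ∉ L
    y∉L y∈ = x∈p─q⇒x∉q y∈ ∘ L⊆S

  sameLeafStatus-unless-moved : (v ∉ L → E' v ≡ E v) → SameLeafStatus E E' v (P v)
  sameLeafStatus-unless-moved {v = v} unmoved with v ∈? L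
  ... | yes v∈L = selected-status v∈L
  ... | no  v∉L = sameLeafStatus-nbhd (unmoved v∉L)

  ─-heavy-invariant : L ⊆ S → ∀ u → ⌊ 2 ≤? ∣ E' u ─ S ∣ ⌋ ≡ ⌊ 2 ≤? ∣ E u ─ S ∣ ⌋
  ─-heavy-invariant {S = S} L⊆S u with u ∈? L
  ... | no u∉L  = cong (λ s → ⌊ 2 ≤? ∣ s ∣ ⌋) (unselected-nbhd-─ L⊆S u∉L)
  ... | yes u∈L = ≡-if-T-either λ
    { (inj₁ heavy') → contradiction (toWitness heavy') (light (reconfigured-leafInto u∈L))
    ; (inj₂ heavy)  → contradiction (toWitness heavy) (light (selected-leafInto u∈L))
    }
    where
    light : ∀ {F} → IsLeafInto F u (P u) → ¬ 2 ≤ ∣ F u ─ S ∣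
    light {F} (leafInto leaf _) = ∣p∣≡1⇒¬2≤∣p─q∣ {p = F u} leaf

  untouched-nbhd : x ∉ L → (∀ {y} → y ∈ L → x ∉ P y) → E' x ≡ E x
  untouched-nbhd {x = x} x∉L x∉P = ⊆-antisym old-edges kept-edges
    where
    old-edges : E' x ⊆ E x
    old-edges y∈E'x with edge⁻ y∈E'x
    ... | inj₁ (y∈Ex , _)          = y∈Ex
    ... | inj₂ (inj₁ (x∈L , _))    = contradiction x∈L x∉L
    ... | inj₂ (inj₂ (y∈L , refl)) = contradiction (c∈P y∈L) (x∉P y∈L)
    kept-edges : E x ⊆ E' x
    kept-edges {y} y∈Ex with y ∈? L
    ... | no y∉L  = unselected-adjacency⁺ x∉L y∉L y∈Ex
    ... | yes y∈L =
      contradiction (leafInto-parent∈ (selected-leafInto y∈L) (E-sym y x y∈Ex)) (x∉P y∈L)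

module LeafFilter {n} (a b : Fin n → Bool) (d : Fin n → Subset n → Bool) where

  qualifies : EdgeSet n → (Fin n → Subset n) → Fin n → Bool
  qualifies E P v = isLeaf E v ∧ a v ∧ b v ∧ parentIn E v (P v) ∧ d v (P v)

  leafFilter : EdgeSet n → (Fin n → Subset n) → Subset n
  leafFilter E P = tabulate (qualifies E P)

  ∈leafFilter⁻ : ∀ {P} → v ∈ leafFilter E P → IsLeafInto E v (P v) × T (a v) × T (b v)
  ∈leafFilter⁻ {v = v} {E = E} v∈ =
    let isLeaf , rest₁ = T-∧⁻ (∈-tabulate⁻ v∈)
        av , rest₂     = T-∧⁻ rest₁
        bv , rest₃     = T-∧⁻ rest₂
        parent∈P , _   = T-∧⁻ rest₃
    in leafInto (toWitness {a? = ∣ E v ∣ ≟ 1} isLeaf) parent∈P , av , bv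

  ∈either-leafFilter⁻ : ∀ {P P'} → v ∈ leafFilter E' P' ⊎ v ∈ leafFilter E P →
                        (∣ E' v ∣ ≡ 1 ⊎ ∣ E v ∣ ≡ 1) × T (a v) × T (b v)
  ∈either-leafFilter⁻ {E' = E'} {E = E} {P} {P'} (inj₁ v∈) =
    let leafInto leaf _ , av , bv = ∈leafFilter⁻ {E = E'} {P = P'} v∈ in inj₁ leaf , av , bv
  ∈either-leafFilter⁻ {E' = E'} {E = E} {P} {P'} (inj₂ v∈) =
    let leafInto leaf _ , av , bv = ∈leafFilter⁻ {E = E} {P = P} v∈ in inj₂ leaf , av , bv

  leafFilter-congʳ : ∀ {P P'} → (∀ v → P' v ≡ P v) → leafFilter E P' ≡ leafFilter E P
  leafFilter-congʳ {E = E} P'≗P =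
    tabulate-cong λ v → cong (λ Q → isLeaf E v ∧ a v ∧ b v ∧ parentIn E v Q ∧ d v Q) (P'≗P v)

  leafFilter-congˡ : ∀ {P} →
    (∀ v → v ∈ leafFilter E' P ⊎ v ∈ leafFilter E P → SameLeafStatus E E' v (P v)) →
    leafFilter E' P ≡ leafFilter E P
  leafFilter-congˡ {P = P} same = tabulate-cong λ v → ≡-if-T-either λ qualified →
    let sameLeafStatus isLeaf≡ parentIn≡ = same v (Sum.map ∈-tabulate⁺ ∈-tabulate⁺ qualified)
    in cong₂ (λ l p → l ∧ a v ∧ b v ∧ p ∧ d v (P v)) isLeaf≡ parentIn≡

sameSelection-by-case :
  ∀ {L₁ L₁' L₂ L₂' : Subset n} {P₁ P₂ P₂' : Fin n → Subset n} {E E' : EdgeSet n}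
  (chooseFirst : Subset n → Bool) →
  (LeafReconf E (L₁ , P₁) E' → L₁' ≡ L₁) →
  (LeafReconf E (L₂ , P₂) E' → L₁' ≡ L₁ × L₂' ≡ L₂ × (∀ v → P₂' v ≡ P₂ v)) →
  LeafReconf E (if chooseFirst L₁ then (L₁ , P₁) else (L₂ , P₂)) E' →
  SameSelection (if chooseFirst L₁' then (L₁' , P₁) else (L₂' , P₂'))
                (if chooseFirst L₁  then (L₁  , P₁) else (L₂  , P₂))
sameSelection-by-case {L₁ = L₁} chooseFirst case₁ case₂ reconf with chooseFirst L₁ in first
... | true  rewrite case₁ reconf | first = refl , λ _ _ → refl
... | false with case₂ reconf
...   | refl , L₂'≡L₂ , P₂'≗P₂ rewrite first = L₂'≡L₂ , λ v _ → P₂'≗P₂ v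

module StrategyReconfiguration {n} (G : Graph n) (R : Subset n) where

  module S (E : EdgeSet n) = Strategy G E R

  lowDegree highDegree : Fin n → Bool
  lowDegree  v = ⌊ deg G v ^ 3 ≤? n ⌋
  highDegree v = ⌊ n <? deg G v ^ 3 ⌋

  -- Definitionally S.L₁ E = F₁.leafFilter E (S.P₁ E) and S.L₂ E = F₂.leafFilter E (S.P₂ E).
  module F₁ = LeafFilter (_∈ᵇ R) lowDegree (λ v Pv → ⌊ deg G v ≤? 2 * ∣ Pv ∣ ⌋)
  module F₂ = LeafFilter (_∈ᵇ R) highDegree (λ v Pv → ⌊ deg G v ≤? 4 * ∣ Pv ∣ ⌋)

  lowDegree⇒¬highDegree : T (lowDegree v) → ¬ T (highDegree v)
  lowDegree⇒¬highDegree {v = v} low-v high-v =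
    <⇒≱ (toWitness {a? = n <? deg G v ^ 3} high-v) (toWitness {a? = deg G v ^ 3 ≤? n} low-v)

  ∈P₁⇒highDegree : ∀ E → u ∈ S.P₁ E v → T (u ∈ᵇ R) → T (highDegree u)
  ∈P₁⇒highDegree _ u∈P₁ = T-not∨⁻ (proj₂ (T-∧⁻ (∈-tabulate⁻ u∈P₁)))

  ∈P₂⇒heavy : ∀ E → u ∈ S.P₂ E v → T (u ∈ᵇ R) → 2 ≤ ∣ E u ─ R ∣
  ∈P₂⇒heavy {u = u} E u∈P₂ u∈R =
    toWitness {a? = 2 ≤? ∣ E u ─ R ∣} (T-not∨⁻ (proj₂ (T-∧⁻ (∈-tabulate⁻ u∈P₂))) u∈R)

  L₁-selection : ∀ E → IsLeafSelection E (S.L₁ E) (S.P₁ E)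
  L₁-selection E = record
    { selected-leafInto = proj₁ ∘ F₁.∈leafFilter⁻ {E = E}
    ; P-avoids-L        = λ _ u∈P₁ u∈L₁ →
        let _ , u∈R , low-u = F₁.∈leafFilter⁻ {E = E} u∈L₁
        in lowDegree⇒¬highDegree low-u (∈P₁⇒highDegree E u∈P₁ u∈R)
    }

  L₂-selection : ∀ E → IsLeafSelection E (S.L₂ E) (S.P₂ E)
  L₂-selection E = record
    { selected-leafInto = proj₁ ∘ F₂.∈leafFilter⁻ {E = E}
    ; P-avoids-L        = λ _ u∈P₂ u∈L₂ →
        let leafInto leaf _ , u∈R , _ = F₂.∈leafFilter⁻ {E = E} u∈L₂
        in ∣p∣≡1⇒¬2≤∣p─q∣ {p = E _} leaf (∈P₂⇒heavy E u∈P₂ u∈R)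
    }

  module _ {E E' : EdgeSet n} (E-sym : ∀ u v → u ∈ E v → v ∈ E u) where

    L₁-reconf-preserves-L₁ : LeafReconf E (S.L₁ E , S.P₁ E) E' → S.L₁ E' ≡ S.L₁ E
    L₁-reconf-preserves-L₁ reconf = F₁.leafFilter-congˡ {E' = E'} {E = E} λ v v∈ →
      let _ , v∈R , low-v = F₁.∈either-leafFilter⁻ {E' = E'} {E = E} v∈
      in sameLeafStatus-unless-moved λ v∉L₁ →
           untouched-nbhd v∉L₁ λ _ v∈P₁ → lowDegree⇒¬highDegree low-v (∈P₁⇒highDegree E v∈P₁ v∈R)
      where open Reconfiguration E-sym (L₁-selection E) reconf

    module _ (reconf : LeafReconf E (S.L₂ E , S.P₂ E) E') where

      open Reconfiguration E-sym (L₂-selection E) reconf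

      L₂-reconf-preserves-heavy : ∀ u → ⌊ 2 ≤? ∣ E' u ─ R ∣ ⌋ ≡ ⌊ 2 ≤? ∣ E u ─ R ∣ ⌋
      L₂-reconf-preserves-heavy = ─-heavy-invariant λ v∈L₂ →
        T-lookup⇒∈ (proj₁ (proj₂ (F₂.∈leafFilter⁻ {E = E} {P = S.P₂ E} v∈L₂)))

      L₂-reconf-preserves-P₂ : ∀ v → S.P₂ E' v ≡ S.P₂ E v
      L₂-reconf-preserves-P₂ v = tabulate-cong λ u →
        cong (λ heavy → (u ∈ᵇ N G v) ∧ (not (u ∈ᵇ R) ∨ heavy)) (L₂-reconf-preserves-heavy u)

      L₂-reconf-fixes-leaf∈R : T (v ∈ᵇ R) → v ∉ S.L₂ E → ∣ E' v ∣ ≡ 1 ⊎ ∣ E v ∣ ≡ 1 → E' v ≡ E v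
      L₂-reconf-fixes-leaf∈R {v = v} v∈R v∉L₂ leaf =
        untouched-nbhd v∉L₂ λ _ v∈P₂ → ¬heavy leaf (∈P₂⇒heavy E v∈P₂ v∈R)
        where
        ¬heavy : ∣ E' v ∣ ≡ 1 ⊎ ∣ E v ∣ ≡ 1 → ¬ 2 ≤ ∣ E v ─ R ∣
        ¬heavy (inj₂ leaf)  = ∣p∣≡1⇒¬2≤∣p─q∣ {p = E v} leaf
        ¬heavy (inj₁ leaf') = ∣p∣≡1⇒¬2≤∣p─q∣ {p = E' v} leaf'
          ∘ toWitness ∘ subst T (sym (L₂-reconf-preserves-heavy v)) ∘ fromWitness

      L₂-reconf-preserves-L₁ : S.L₁ E' ≡ S.L₁ E
      L₂-reconf-preserves-L₁ = F₁.leafFilter-congˡ {E' = E'} {E = E} λ v v∈ →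
        let leaf , v∈R , low-v = F₁.∈either-leafFilter⁻ {E' = E'} {E = E} v∈
            v∉L₂ : v ∉ S.L₂ E
            v∉L₂ v∈L₂ = lowDegree⇒¬highDegree low-v (proj₂ (proj₂ (F₂.∈leafFilter⁻ {E = E} v∈L₂)))
        in sameLeafStatus-nbhd (L₂-reconf-fixes-leaf∈R v∈R v∉L₂ leaf)

      L₂-reconf-preserves-L₂ : S.L₂ E' ≡ S.L₂ E
      L₂-reconf-preserves-L₂ =
        trans (F₂.leafFilter-congʳ {E = E'} L₂-reconf-preserves-P₂) $
        F₂.leafFilter-congˡ {E' = E'} {E = E} λ v v∈ →
          let leaf , v∈R , _ = F₂.∈either-leafFilter⁻ {E' = E'} {E = E} v∈
          in sameLeafStatus-unless-moved λ v∉L₂ → L₂-reconf-fixes-leaf∈R v∈R v∉L₂ leaf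

    -- The implicit arguments are given because inferring them from the goal makes Agda
    -- normalise the strategy's degree thresholds, which exhausts memory.
    𝒮-reversible : LeafReconf E (S.𝒮 E) E' → SameSelection (S.𝒮 E') (S.𝒮 E)
    𝒮-reversible = sameSelection-by-case {L₁ = S.L₁ E} {S.L₁ E'}
      (λ L → ⌊ n ≤? 256 * ∣ L ∣ ⌋) L₁-reconf-preserves-L₁
      λ reconf →
        L₂-reconf-preserves-L₁ reconf , L₂-reconf-preserves-L₂ reconf , L₂-reconf-preserves-P₂ reconf

lemma3p2 : (n : ℕ) (G : Graph n) → Reversible G (strategy G)
lemma3p2 n G E E' R tree = StrategyReconfiguration.𝒮-reversible G R {E} {E'} (symm tree)
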